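{- Let $L$ be a finite geometric lattice. Then the minors of $(L,\operatorname{irr}(L))$ are exactly the generator enriched lattices of the form $\langle \ell_1,\dots,\ell_k|\ell\rangle$ where $\ell\in L$ and each $\ell_i$ covers $\ell$ in $L$ ($1\le i\le k$). In particular, every minor $(K,H)$ of $(L,\operatorname{irr}(L))$ is minimally generated (i.e. $H=\operatorname{irr}(K)$) and $K$ is geometric.
   Context: $\operatorname{irr}(L)$ is the set of join irreducible elements of $L$. A generator enriched lattice is a pair $(L,G)$ with $L$ a finite lattice and $G\subseteq L\setminus\{\widehat0\}$ generating $L$ under joins; it is minimally generated if $G=\operatorname{irr}(L)$. For $H\subseteq L$ and $z\in L$ with $z<h$ for all $h\in H$, $\langle H|z\rangle$ denotes $(\{z\}\cup\{\bigvee_{x\in S}x:\emptyset\ne S\subseteq H\},H)$. For $I\subseteq G$: deletion $(L,G)\setminus I=\langle G\setminus I|\widehat0_L\rangle$; with $i_0=\bigvee_{i\in I}i$ and $J=\{g\vee i_0:g\in G\}\setminus\{i_0\}$, contraction $(L,G)/I=\langle J|i_0\rangle$. A minor is the result of any finite sequence of deletions and contractions applied to $(L,G)$. A finite lattice is geometric if it is atomistic and semimodular. -}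

module Defs where

open import Data.Nat using (ℕ)
open import Data.Fin using (Fin)
open import Data.Fin.Subset using (Subset; _∈_; _⊆_; _─_; Nonempty)
open import Data.Product using (Σ; ∃; _×_)
open import Data.Sum using (_⊎_)
open import Data.Unit using (⊤)
open import Data.Empty using (⊥)
open import Relation.Nullary using (¬_)
open import Relation.Binary.PropositionalEquality using (_≡_; _≢_)
open import Function.Bundles using (_⇔_)

-- A finite lattice L is represented on the carrier Fin n, ordered by _≤_.
-- Subsets of L that serve as carriers of (sub)posets K are predicates
-- Fin n → Set (with the order induced from L); generator sets G, H, I, J
-- are decidable finite subsets (Data.Fin.Subset).
module Order {n : ℕ} (_≤_ : Fin n → Fin n → Set) where

  Carrier : Set₁
  Carrier = Fin n → Set

  full : Carrier
  full _ = ⊤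

  _<_ : Fin n → Fin n → Set
  x < y = x ≤ y × x ≢ y

  UpperIn : Carrier → (Fin n → Set) → Fin n → Set
  UpperIn K A x = K x × (∀ a → A a → a ≤ x)

  LowerIn : Carrier → (Fin n → Set) → Fin n → Set
  LowerIn K A x = K x × (∀ a → A a → x ≤ a)

  IsLubIn : Carrier → (Fin n → Set) → Fin n → Set
  IsLubIn K A x = UpperIn K A x × (∀ y → UpperIn K A y → x ≤ y)

  IsGlbIn : Carrier → (Fin n → Set) → Fin n → Set
  IsGlbIn K A x = LowerIn K A x × (∀ y → LowerIn K A y → y ≤ x)

  Pair : Fin n → Fin n → Fin n → Set
  Pair a b c = c ≡ a ⊎ c ≡ b

  IsJoin2 : Carrier → Fin n → Fin n → Fin n → Set
  IsJoin2 K a b x = IsLubIn K (Pair a b) x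

  IsMeet2 : Carrier → Fin n → Fin n → Fin n → Set
  IsMeet2 K a b x = IsGlbIn K (Pair a b) x

  IsLeastIn : Carrier → Fin n → Set
  IsLeastIn K z = K z × (∀ y → K y → z ≤ y)

  CoversIn : Carrier → Fin n → Fin n → Set
  CoversIn K a b = K a × K b × a < b × (∀ c → K c → a < c → c < b → ⊥)

  IsLatticeOn : Carrier → Set
  IsLatticeOn K = (∃ λ x → K x)
                × (∀ a b → K a → K b → ∃ λ x → IsJoin2 K a b x)
                × (∀ a b → K a → K b → ∃ λ x → IsMeet2 K a b x)

  AtomIn : Carrier → Fin n → Set
  AtomIn K a = ∃ λ z → IsLeastIn K z × CoversIn K z a

  Atomistic : Carrier → Set
  Atomistic K = ∀ x → K x → IsLubIn K (λ a → AtomIn K a × a ≤ x) x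

  Semimodular : Carrier → Set
  Semimodular K = ∀ x y m j → K x → K y → IsMeet2 K x y m → IsJoin2 K x y j
                  → CoversIn K m x → CoversIn K y j

  IsGeometric : Carrier → Set
  IsGeometric K = IsLatticeOn K × Atomistic K × Semimodular K

  JoinIrr : Carrier → Fin n → Set
  JoinIrr K x = K x × ¬ IsLeastIn K x
              × (∀ a b → K a → K b → IsJoin2 K a b x → a ≡ x ⊎ b ≡ x)

  -- carrier of ⟨H | z⟩ : {z} ∪ { ⋁ S : ∅ ≠ S ⊆ H }, joins taken in K
  Gen : Carrier → Subset n → Fin n → Carrier
  Gen K H z x = x ≡ z
              ⊎ Σ (Subset n) (λ S → Nonempty S × S ⊆ H × IsLubIn K (λ s → s ∈ S) x)

  data IsMinor (K₀ : Carrier) (G₀ : Subset n) : Carrier → Subset n → Set₁ where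
    base : IsMinor K₀ G₀ K₀ G₀
    -- (K,G) \ I = ⟨ G \ I | 0̂_K ⟩
    del  : ∀ {K G} (I : Subset n) (z : Fin n)
         → IsMinor K₀ G₀ K G → I ⊆ G → IsLeastIn K z
         → IsMinor K₀ G₀ (Gen K (G ─ I) z) (G ─ I)
    -- (K,G) / I = ⟨ J | i₀ ⟩, i₀ = ⋁ I, J = { g ∨ i₀ : g ∈ G } \ {i₀}
    con  : ∀ {K G} (I : Subset n) (i₀ : Fin n) (J : Subset n)
         → IsMinor K₀ G₀ K G → I ⊆ G → IsLubIn K (λ i → i ∈ I) i₀
         → (∀ x → (x ∈ J) ⇔ ((∃ λ g → g ∈ G × IsJoin2 K g i₀ x) × x ≢ i₀))
         → IsMinor K₀ G₀ (Gen K J i₀) J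

-- If H consists of covers of ℓ, the generator enriched lattice ⟨H | ℓ⟩ is again geometric with
-- irr = H: it is closed under joins, and semimodularity lifts from L along the coverings ℓ ⋖ h.
-- L itself is ⟨atoms | 0̂⟩, and such presentations are preserved by deletion (ℓ stays, H shrinks)
-- and contraction (ℓ becomes i₀, and each g ∨ i₀ ≠ i₀ covers i₀ by semimodularity). Conversely
-- ⟨H | ℓ⟩ arises by contracting the atoms below ℓ, which yields all covers of ℓ, and then deleting
-- the covers outside H.
module Submission where

open import Defs
open import Level using (0ℓ)
open import Data.Nat using (ℕ)
open import Data.Fin using (Fin)
open import Data.Fin.Properties using (_≟_; any?; all?)
open import Data.Fin.Subset using (Subset; _∈_; _⊆_; _─_; _∪_; ⁅_⁆; inside; outside)
open import Data.Fin.Subset.Properties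
  using (_∈?_; nonempty?; x∈p∪q⁻; x∈p∪q⁺; x∈⁅x⁆; x∈⁅y⁆⇒x≡y; p─q⊆p; drop-∷-⊆)
open import Data.Product using (Σ; ∃; _×_; _,_; proj₁; proj₂)
open import Data.Product.Function.NonDependent.Propositional using (_×-⇔_)
open import Data.Sum using (_⊎_; inj₁; inj₂; [_,_]′; map₂)
open import Data.Unit using (tt)
open import Data.Empty using (⊥-elim)
open import Data.Bool using (Bool)
open import Data.Bool.Properties using (T-≡)
open import Data.List using (List; []; _∷_; foldr; filter; allFin)
open import Data.List.Membership.Propositional using () renaming (_∈_ to _∈ₗ_)
open import Data.List.Membership.Propositional.Properties using (∈-filter⁺; ∈-filter⁻; ∈-allFin)
open import Data.List.Relation.Unary.Any using (here; there)
open import Data.Vec using (tabulate; []; _∷_; here)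
open import Data.Vec.Properties using (lookup∘tabulate; []=⇒lookup; lookup⇒[]=)
open import Algebra.Core using (Op₂)
open import Relation.Unary using (Pred; Decidable)
open import Relation.Nullary using (¬_; Dec; yes; no; isYes; ¬?)
open import Relation.Nullary.Decidable using (map′; _×-dec_; toWitness; fromWitness)
open import Relation.Binary.PropositionalEquality using (_≡_; _≢_; refl; sym; trans; subst; cong)
open import Relation.Binary.Lattice using (IsLattice)
open import Function.Bundles using (_⇔_; mk⇔; Equivalence)
open import Function.Properties.Equivalence using ()
  renaming (refl to ⇔-refl; sym to ⇔-sym; trans to ⇔-trans)
open Equivalence using (to; from)

subset : ∀ {n} {P : Pred (Fin n) 0ℓ} → Decidable P → Subset n
subset P? = tabulate (λ x → isYes (P? x))

∈-subset⇔ : ∀ {n} {P : Pred (Fin n) 0ℓ} (P? : Decidable P) x → x ∈ subset P? ⇔ P x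
∈-subset⇔ P? x = mk⇔
  (λ x∈ → toWitness {a? = P? x} (from T-≡ (trans (sym (lookup∘tabulate f x)) ([]=⇒lookup x∈))))
  (λ Px → lookup⇒[]= x _ (trans (lookup∘tabulate f x) (to T-≡ (fromWitness {a? = P? x} Px))))
  where
  f : Fin _ → Bool
  f y = isYes (P? y)

p─[p─q]≡q : ∀ {n} {p q : Subset n} → q ⊆ p → p ─ (p ─ q) ≡ q
p─[p─q]≡q {p = []}          {[]}          _   = refl
p─[p─q]≡q {p = inside ∷ p}  {inside ∷ q}  q⊆p = cong (inside ∷_) (p─[p─q]≡q (drop-∷-⊆ q⊆p))
p─[p─q]≡q {p = inside ∷ p}  {outside ∷ q} q⊆p = cong (outside ∷_) (p─[p─q]≡q (drop-∷-⊆ q⊆p))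
p─[p─q]≡q {p = outside ∷ p} {outside ∷ q} q⊆p = cong (outside ∷_) (p─[p─q]≡q (drop-∷-⊆ q⊆p))
p─[p─q]≡q {p = outside ∷ p} {inside ∷ q}  q⊆p with q⊆p here
... | ()

module LatticeFacts {n : ℕ} {_≤_ : Fin n → Fin n → Set} {_∨_ _∧_ : Op₂ (Fin n)}
  (isLattice : IsLattice _≡_ _≤_ _∨_ _∧_) where

  open Order _≤_
  open IsLattice isLattice
    using (x≤x∨y; y≤x∨y; ∨-least; x∧y≤x; x∧y≤y; ∧-greatest)
    renaming (refl to ≤-refl; trans to ≤-trans; antisym to ≤-antisym)

  x≤y⇒x∨y≡y : ∀ {x y} → x ≤ y → x ∨ y ≡ y
  x≤y⇒x∨y≡y {x} {y} x≤y = ≤-antisym (∨-least x≤y ≤-refl) (y≤x∨y x y)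

  y≤x⇒x∨y≡x : ∀ {x y} → y ≤ x → x ∨ y ≡ x
  y≤x⇒x∨y≡x {x} {y} y≤x = ≤-antisym (∨-least ≤-refl y≤x) (x≤x∨y x y)

  ≤-dec : ∀ x y → Dec (x ≤ y)
  ≤-dec x y = map′ (λ x∨y≡y → subst (x ≤_) x∨y≡y (x≤x∨y x y)) x≤y⇒x∨y≡y (x ∨ y ≟ y)

  <-dec : ∀ x y → Dec (x < y)
  <-dec x y = ≤-dec x y ×-dec ¬? (x ≟ y)

  covers-dec : ∀ a b → Dec (CoversIn full a b)
  covers-dec a b = map′
    (λ (a<b , nothingBetween) → tt , tt , a<b , λ c _ a<c c<b → nothingBetween c (a<c , c<b))
    (λ (_ , _ , a<b , nothingBetween) → a<b , λ c (a<c , c<b) → nothingBetween c tt a<c c<b)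
    (<-dec a b ×-dec all? (λ c → ¬? (<-dec a c ×-dec <-dec c b)))

  ⋖⇒≤ : ∀ {K a b} → CoversIn K a b → a ≤ b
  ⋖⇒≤ (_ , _ , (a≤b , _) , _) = a≤b

  ⋖⇒≢ : ∀ {K a b} → CoversIn K a b → a ≢ b
  ⋖⇒≢ (_ , _ , (_ , a≢b) , _) = a≢b

  ⋖-restrict : ∀ {K a b} → K a → K b → CoversIn full a b → CoversIn K a b
  ⋖-restrict Ka Kb (_ , _ , a<b , nothingBetween) = Ka , Kb , a<b , λ c _ → nothingBetween c tt

  ⋖-between : ∀ {K a b c} → CoversIn K a b → K c → a ≤ c → c ≤ b → c ≡ a ⊎ c ≡ b
  ⋖-between {a = a} {b = b} {c = c} (_ , _ , _ , nothingBetween) Kc a≤c c≤b with c ≟ a | c ≟ b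
  ... | yes c≡a | _       = inj₁ c≡a
  ... | no _    | yes c≡b = inj₂ c≡b
  ... | no c≢a  | no c≢b  = ⊥-elim (nothingBetween c Kc (a≤c , λ a≡c → c≢a (sym a≡c)) (c≤b , c≢b))

  ⋖-absorb : ∀ {K m x h} → CoversIn K m x → K (h ∨ m) → ¬ h ≤ m → h ≤ x → h ∨ m ≡ x
  ⋖-absorb {m = m} {h = h} m⋖x Kh∨m h≰m h≤x
    with ⋖-between m⋖x Kh∨m (y≤x∨y h m) (∨-least h≤x (⋖⇒≤ m⋖x))
  ... | inj₁ h∨m≡m = ⊥-elim (h≰m (subst (h ≤_) h∨m≡m (x≤x∨y h m)))
  ... | inj₂ h∨m≡x = h∨m≡x

  ∨-isJoinIn : ∀ {K} a b → K (a ∨ b) → IsJoin2 K a b (a ∨ b)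
  ∨-isJoinIn a b Ka∨b = (Ka∨b , λ { _ (inj₁ refl) → x≤x∨y a b ; _ (inj₂ refl) → y≤x∨y a b })
                      , λ c (_ , ub) → ∨-least (ub a (inj₁ refl)) (ub b (inj₂ refl))

  semimodular⇒⋖-∨ : Semimodular full → ∀ {m g y}
                  → CoversIn full m g → m ≤ y → g ∨ y ≢ y → CoversIn full y (g ∨ y)
  semimodular⇒⋖-∨ semimodular {m} {g} {y} m⋖g m≤y g∨y≢y =
    semimodular g y (g ∧ y) (g ∨ y) tt tt (∧-isMeet g y) (∨-isJoinIn g y tt) g∧y⋖g
    where
    g∧y⋖g : CoversIn full (g ∧ y) g
    g∧y⋖g with ⋖-between m⋖g tt (∧-greatest (⋖⇒≤ m⋖g) m≤y) (x∧y≤x g y)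
    ... | inj₁ g∧y≡m = subst (λ t → CoversIn full t g) (sym g∧y≡m) m⋖g
    ... | inj₂ g∧y≡g = ⊥-elim (g∨y≢y (x≤y⇒x∨y≡y (subst (_≤ y) g∧y≡g (x∧y≤y g y))))

    ∧-isMeet : ∀ a b → IsMeet2 full a b (a ∧ b)
    ∧-isMeet a b = (tt , λ { _ (inj₁ refl) → x∧y≤x a b ; _ (inj₂ refl) → x∧y≤y a b })
                 , λ c (_ , lb) → ∧-greatest (lb a (inj₁ refl)) (lb b (inj₂ refl))

  lub-unique : ∀ {K A x y} → IsLubIn K A x → IsLubIn K A y → x ≡ y
  lub-unique ((Kx , ubx) , leastx) ((Ky , uby) , leasty) =
    ≤-antisym (leastx _ (Ky , uby)) (leasty _ (Kx , ubx))

  least-unique : ∀ {K x y} → IsLeastIn K x → IsLeastIn K y → x ≡ y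
  least-unique (Kx , x≤) (Ky , y≤) = ≤-antisym (x≤ _ Ky) (y≤ _ Kx)

  lub-resp-⇔ : ∀ {K A B x} → (∀ a → A a ⇔ B a) → IsLubIn K A x → IsLubIn K B x
  lub-resp-⇔ A⇔B ((Kx , ub) , least) =
      (Kx , λ a Ba → ub a (from (A⇔B a) Ba))
    , λ y (Ky , ub′) → least y (Ky , λ a Aa → ub′ a (to (A⇔B a) Aa))

  lub-restrict : ∀ {K A x} → K x → IsLubIn full A x → IsLubIn K A x
  lub-restrict Kx ((_ , ub) , least) = (Kx , ub) , λ y (_ , ub′) → least y (tt , ub′)

  ⁅⁆-isLub : ∀ h → IsLubIn full (_∈ ⁅ h ⁆) h
  ⁅⁆-isLub h = (tt , λ a a∈ → subst (_≤ h) (sym (x∈⁅y⁆⇒x≡y h a∈)) ≤-refl) , λ y (_ , ub) → ub h (x∈⁅x⁆ h)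

  ∪-isLub : ∀ {S S′ a b} → IsLubIn full (_∈ S) a → IsLubIn full (_∈ S′) b
          → IsLubIn full (_∈ S ∪ S′) (a ∨ b)
  ∪-isLub {S} {S′} {a} {b} ((_ , ubS) , leastS) ((_ , ubS′) , leastS′) =
      (tt , λ c c∈ → [ (λ c∈S → ≤-trans (ubS c c∈S) (x≤x∨y a b))
                     , (λ c∈S′ → ≤-trans (ubS′ c c∈S′) (y≤x∨y a b)) ]′ (x∈p∪q⁻ S S′ c∈))
    , λ y (_ , ub) → ∨-least (leastS y (tt , λ c c∈S → ub c (x∈p∪q⁺ (inj₁ c∈S))))
                             (leastS′ y (tt , λ c c∈S′ → ub c (x∈p∪q⁺ (inj₂ c∈S′))))

  lub≰⇒∃≰ : ∀ {A x m} → Decidable A → IsLubIn full A x → ¬ x ≤ m → ∃ λ a → A a × ¬ a ≤ m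
  lub≰⇒∃≰ {A} {x} {m} A? (_ , least) x≰m with any? (λ a → A? a ×-dec ¬? (≤-dec a m))
  ... | yes witness = witness
  ... | no none     = ⊥-elim (x≰m (least m (tt , allBelow)))
    where
    allBelow : ∀ a → A a → a ≤ m
    allBelow a Aa with ≤-dec a m
    ... | yes a≤m = a≤m
    ... | no a≰m  = ⊥-elim (none (a , Aa , a≰m))

  ⋁ : Fin n → List (Fin n) → Fin n
  ⋁ b xs = foldr _∨_ b xs

  b≤⋁ : ∀ b xs → b ≤ ⋁ b xs
  b≤⋁ b []       = ≤-refl
  b≤⋁ b (x ∷ xs) = ≤-trans (b≤⋁ b xs) (y≤x∨y x _)

  ∈⇒≤⋁ : ∀ {a} b xs → a ∈ₗ xs → a ≤ ⋁ b xs
  ∈⇒≤⋁ b (x ∷ xs) (here refl) = x≤x∨y x _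
  ∈⇒≤⋁ b (x ∷ xs) (there a∈)  = ≤-trans (∈⇒≤⋁ b xs a∈) (y≤x∨y x _)

  ⋁-least : ∀ {y} b xs → b ≤ y → (∀ a → a ∈ₗ xs → a ≤ y) → ⋁ b xs ≤ y
  ⋁-least b []       b≤y _  = b≤y
  ⋁-least b (x ∷ xs) b≤y ub = ∨-least (ub x (here refl)) (⋁-least b xs b≤y (λ a a∈ → ub a (there a∈)))

  ∨-Closed : Carrier → Set
  ∨-Closed K = ∀ a b → K a → K b → K (a ∨ b)

  ⋁-closed : ∀ {K} → ∨-Closed K → ∀ b xs → K b → (∀ a → a ∈ₗ xs → K a) → K (⋁ b xs)
  ⋁-closed closed b []       Kb _   = Kb
  ⋁-closed closed b (x ∷ xs) Kb Kxs =
    closed x _ (Kxs x (here refl)) (⋁-closed closed b xs Kb (λ a a∈ → Kxs a (there a∈)))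

  elements : Subset n → List (Fin n)
  elements S = filter (_∈? S) (allFin n)

  ∈-elements⇔ : ∀ S a → a ∈ₗ elements S ⇔ a ∈ S
  ∈-elements⇔ S a = mk⇔ (λ a∈ → proj₂ (∈-filter⁻ (_∈? S) {xs = allFin n} a∈))
                        (∈-filter⁺ (_∈? S) (∈-allFin a))

  ⋁-elements-isLub : ∀ {S s} → s ∈ S → IsLubIn full (_∈ S) (⋁ s (elements S))
  ⋁-elements-isLub {S} {s} s∈S =
      (tt , λ a a∈S → ∈⇒≤⋁ s (elements S) (from (∈-elements⇔ S a) a∈S))
    , λ y (_ , ub) → ⋁-least s (elements S) (ub s s∈S) (λ a a∈ → ub a (to (∈-elements⇔ S a) a∈))

  lub-closed : ∀ {K S s x} → ∨-Closed K → s ∈ S → (∀ a → a ∈ S → K a)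
             → IsLubIn full (_∈ S) x → K x
  lub-closed {K} {S} {s} closed s∈S S⊆K lub =
    subst K (lub-unique (⋁-elements-isLub s∈S) lub)
      (⋁-closed closed s (elements S) (S⊆K s s∈S) (λ a a∈ → S⊆K a (to (∈-elements⇔ S a) a∈)))

  lub-extend : ∀ {K S s x} → ∨-Closed K → s ∈ S → (∀ a → a ∈ S → K a)
             → IsLubIn K (_∈ S) x → IsLubIn full (_∈ S) x
  lub-extend {K} {S} {s} {x} closed s∈S S⊆K ((_ , ubK) , leastK) =
    subst (IsLubIn full (_∈ S)) (sym x≡⋁S) ⋁S-isLub
    where
    ⋁S-isLub : IsLubIn full (_∈ S) (⋁ s (elements S))
    ⋁S-isLub = ⋁-elements-isLub s∈S
    x≡⋁S : x ≡ ⋁ s (elements S)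
    x≡⋁S = ≤-antisym (leastK _ (lub-closed closed s∈S S⊆K ⋁S-isLub , proj₂ (proj₁ ⋁S-isLub)))
                     (proj₂ ⋁S-isLub x (tt , ubK))

  Gen-∨-closed⇔ : ∀ {K J z} → ∨-Closed K → (∀ j → j ∈ J → K j) → ∀ x → Gen K J z x ⇔ Gen full J z x
  Gen-∨-closed⇔ {K} {J} {z} closed J⊆K x = mk⇔ extend restrict
    where
    extend : Gen K J z x → Gen full J z x
    extend (inj₁ x≡z) = inj₁ x≡z
    extend (inj₂ (S , (s , s∈S) , S⊆J , lub)) =
      inj₂ (S , (s , s∈S) , S⊆J , lub-extend closed s∈S (λ a a∈ → J⊆K a (S⊆J a∈)) lub)
    restrict : Gen full J z x → Gen K J z x
    restrict (inj₁ x≡z) = inj₁ x≡z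
    restrict (inj₂ (S , (s , s∈S) , S⊆J , lub)) =
      inj₂ (S , (s , s∈S) , S⊆J , lub-restrict (lub-closed closed s∈S (λ a a∈ → J⊆K a (S⊆J a∈)) lub) lub)

  Gen-mono : ∀ {K H H′ z} → H ⊆ H′ → ∀ x → Gen K H z x → Gen K H′ z x
  Gen-mono H⊆H′ x (inj₁ x≡z)                 = inj₁ x≡z
  Gen-mono H⊆H′ x (inj₂ (S , ne , S⊆H , lub)) = inj₂ (S , ne , (λ s∈ → H⊆H′ (S⊆H s∈)) , lub)

  joinIrr-⋁ : ∀ {K b x} → ∨-Closed K → K b → ∀ ys → (∀ a → a ∈ₗ ys → K a)
            → JoinIrr K x → x ≡ ⋁ b ys → x ≡ b ⊎ x ∈ₗ ys
  joinIrr-⋁ closed Kb []       Kys ji x≡⋁ = inj₁ x≡⋁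
  joinIrr-⋁ {K} {b} closed Kb (y ∷ ys) Kys ji@(_ , _ , irreducible) x≡⋁ =
    [ (λ y≡x → inj₂ (here (sym y≡x)))
    , (λ ⋁ys≡x → map₂ there (joinIrr-⋁ closed Kb ys Kys′ ji (sym ⋁ys≡x))) ]′
      (irreducible y (⋁ b ys) Ky K⋁ys
        (subst (IsJoin2 K y (⋁ b ys)) (sym x≡⋁) (∨-isJoinIn y (⋁ b ys) (closed y _ Ky K⋁ys))))
    where
    Ky : K y
    Ky = Kys y (here refl)
    Kys′ : ∀ a → a ∈ₗ ys → K a
    Kys′ a a∈ = Kys a (there a∈)
    K⋁ys : K (⋁ b ys)
    K⋁ys = ⋁-closed closed b ys Kb Kys′

  module CoverGenerated {K : Carrier} {H : Subset n} {ℓ : Fin n}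
    (ℓ⋖H : ∀ h → h ∈ H → CoversIn full ℓ h) (K⇔ : ∀ x → K x ⇔ Gen full H ℓ x) where

    ℓ∈K : K ℓ
    ℓ∈K = from (K⇔ ℓ) (inj₁ refl)

    H⊆K : ∀ h → h ∈ H → K h
    H⊆K h h∈H = from (K⇔ h) (inj₂ (⁅ h ⁆ , (h , x∈⁅x⁆ h) , ⁅h⁆⊆H , ⁅⁆-isLub h))
      where
      ⁅h⁆⊆H : ⁅ h ⁆ ⊆ H
      ⁅h⁆⊆H a∈ = subst (_∈ H) (sym (x∈⁅y⁆⇒x≡y h a∈)) h∈H

    ℓ≤K : ∀ {x} → K x → ℓ ≤ x
    ℓ≤K {x} Kx with to (K⇔ x) Kx
    ... | inj₁ refl = ≤-refl
    ... | inj₂ (S , (s , s∈S) , S⊆H , lub) = ≤-trans (⋖⇒≤ (ℓ⋖H s (S⊆H s∈S))) (proj₂ (proj₁ lub) s s∈S)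

    ℓ-least : IsLeastIn K ℓ
    ℓ-least = ℓ∈K , λ _ → ℓ≤K

    K-∨-closed : ∨-Closed K
    K-∨-closed a b Ka Kb with to (K⇔ a) Ka | to (K⇔ b) Kb
    ... | inj₁ refl | _         = subst K (sym (x≤y⇒x∨y≡y (ℓ≤K Kb))) Kb
    ... | inj₂ _    | inj₁ refl = subst K (sym (y≤x⇒x∨y≡x (ℓ≤K Ka))) Ka
    ... | inj₂ (S , (s , s∈S) , S⊆H , lubS) | inj₂ (S′ , _ , S′⊆H , lubS′) =
      from (K⇔ (a ∨ b)) (inj₂ (S ∪ S′ , (s , x∈p∪q⁺ (inj₁ s∈S)) , S∪S′⊆H , ∪-isLub lubS lubS′))
      where
      S∪S′⊆H : S ∪ S′ ⊆ H
      S∪S′⊆H c∈ = [ S⊆H , S′⊆H ]′ (x∈p∪q⁻ S S′ c∈)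

    ∨-isJoinInK : ∀ {a b} → K a → K b → IsJoin2 K a b (a ∨ b)
    ∨-isJoinInK {a} {b} Ka Kb = ∨-isJoinIn a b (K-∨-closed a b Ka Kb)

    ≤H⇒ℓ⊎H : ∀ {y h} → K y → y ≤ h → h ∈ H → y ≡ ℓ ⊎ y ≡ h
    ≤H⇒ℓ⊎H {y} {h} Ky y≤h h∈H with to (K⇔ y) Ky
    ... | inj₁ y≡ℓ = inj₁ y≡ℓ
    ... | inj₂ (S , (s , s∈S) , S⊆H , lub) = inj₂ (≤-antisym y≤h (subst (_≤ y) s≡h s≤y))
      where
      s≤y : s ≤ y
      s≤y = proj₂ (proj₁ lub) s s∈S
      s≡h : s ≡ h
      s≡h with ⋖-between (ℓ⋖H h h∈H) tt (⋖⇒≤ (ℓ⋖H s (S⊆H s∈S))) (≤-trans s≤y y≤h)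
      ... | inj₁ s≡ℓ = ⊥-elim (⋖⇒≢ (ℓ⋖H s (S⊆H s∈S)) (sym s≡ℓ))
      ... | inj₂ s≡h = s≡h

    H⇒joinIrr : ∀ {x} → x ∈ H → JoinIrr K x
    H⇒joinIrr {x} x∈H = H⊆K x x∈H , (λ (_ , x≤) → x≰ℓ (x≤ ℓ ℓ∈K)) , irreducible
      where
      x≰ℓ : ¬ x ≤ ℓ
      x≰ℓ x≤ℓ = ⋖⇒≢ (ℓ⋖H x x∈H) (≤-antisym (⋖⇒≤ (ℓ⋖H x x∈H)) x≤ℓ)
      irreducible : ∀ a b → K a → K b → IsJoin2 K a b x → a ≡ x ⊎ b ≡ x
      irreducible a b Ka Kb a∨b=x@((_ , ub) , least)
        with ≤H⇒ℓ⊎H Ka (ub a (inj₁ refl)) x∈H | ≤H⇒ℓ⊎H Kb (ub b (inj₂ refl)) x∈H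
      ... | inj₂ a≡x  | _         = inj₁ a≡x
      ... | inj₁ _    | inj₂ b≡x  = inj₂ b≡x
      ... | inj₁ refl | inj₁ refl =
        ⊥-elim (x≰ℓ (least ℓ (ℓ∈K , λ { _ (inj₁ refl) → ≤-refl ; _ (inj₂ refl) → ≤-refl })))

    joinIrr⇒H : ∀ {x} → JoinIrr K x → x ∈ H
    joinIrr⇒H {x} ji@(Kx , notLeast , _) with to (K⇔ x) Kx
    ... | inj₁ refl = ⊥-elim (notLeast ℓ-least)
    ... | inj₂ (S , (s , s∈S) , S⊆H , lub)
      with joinIrr-⋁ K-∨-closed (S⊆K s s∈S) (elements S) (λ a a∈ → S⊆K a (to (∈-elements⇔ S a) a∈)) ji
                     (lub-unique lub (⋁-elements-isLub s∈S))
      where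
      S⊆K : ∀ a → a ∈ S → K a
      S⊆K a a∈S = H⊆K a (S⊆H a∈S)
    ...   | inj₁ refl = S⊆H s∈S
    ...   | inj₂ x∈   = S⊆H (to (∈-elements⇔ S x) x∈)

    H⇔joinIrr : ∀ x → x ∈ H ⇔ JoinIrr K x
    H⇔joinIrr x = mk⇔ H⇒joinIrr joinIrr⇒H

    -- The meet of a and b is the join of ℓ and the generators lying below both.
    K-meet : ∀ a b → K a → K b → ∃ λ m → IsMeet2 K a b m
    K-meet a b Ka Kb = m , (Km , lower) , greatest
      where
      T? : Decidable (λ h → h ∈ H × h ≤ a × h ≤ b)
      T? h = (h ∈? H) ×-dec (≤-dec h a ×-dec ≤-dec h b)
      T : Subset n
      T = subset T?
      T-elem : ∀ h → h ∈ₗ elements T → h ∈ H × h ≤ a × h ≤ b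
      T-elem h h∈ = to (∈-subset⇔ T? h) (to (∈-elements⇔ T h) h∈)
      m : Fin n
      m = ⋁ ℓ (elements T)
      Km : K m
      Km = ⋁-closed K-∨-closed ℓ (elements T) ℓ∈K (λ h h∈ → H⊆K h (proj₁ (T-elem h h∈)))
      lower : ∀ c → Pair a b c → m ≤ c
      lower c (inj₁ refl) = ⋁-least ℓ (elements T) (ℓ≤K Ka) (λ h h∈ → proj₁ (proj₂ (T-elem h h∈)))
      lower c (inj₂ refl) = ⋁-least ℓ (elements T) (ℓ≤K Kb) (λ h h∈ → proj₂ (proj₂ (T-elem h h∈)))
      greatest : ∀ y → LowerIn K (Pair a b) y → y ≤ m
      greatest y (Ky , lb) with to (K⇔ y) Ky
      ... | inj₁ refl = b≤⋁ ℓ (elements T)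
      ... | inj₂ (S , _ , S⊆H , lub) = proj₂ lub m (tt , λ s s∈S → ∈⇒≤⋁ ℓ (elements T) (s∈T s s∈S))
        where
        s∈T : ∀ s → s ∈ S → s ∈ₗ elements T
        s∈T s s∈S = from (∈-elements⇔ T s) (from (∈-subset⇔ T? s)
          (S⊆H s∈S , ≤-trans s≤y (lb a (inj₁ refl)) , ≤-trans s≤y (lb b (inj₂ refl))))
          where
          s≤y : s ≤ y
          s≤y = proj₂ (proj₁ lub) s s∈S

    H-atoms : ∀ {h} → h ∈ H → AtomIn K h
    H-atoms {h} h∈H = ℓ , ℓ-least , ⋖-restrict ℓ∈K (H⊆K h h∈H) (ℓ⋖H h h∈H)

    K-atomistic : Atomistic K
    K-atomistic x Kx = (Kx , λ _ (_ , a≤x) → a≤x) , least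
      where
      least : ∀ y → UpperIn K (λ a → AtomIn K a × a ≤ x) y → x ≤ y
      least y (Ky , ub) with to (K⇔ x) Kx
      ... | inj₁ refl = ℓ≤K Ky
      ... | inj₂ (S , _ , S⊆H , lub) =
        proj₂ lub y (tt , λ s s∈S → ub s (H-atoms (S⊆H s∈S) , proj₂ (proj₁ lub) s s∈S))

    -- Some generator h ≤ x is not below m = x ∧ y, so h ∨ m = x and x ∨ y = h ∨ y, which covers y
    -- by semimodularity of L.
    K-semimodular : Semimodular full → Semimodular K
    K-semimodular semimodular x y m j Kx Ky m=x∧y j=x∨y m⋖x@(Km , _ , (m≤x , m≢x) , _)
      with to (K⇔ x) Kx
    ... | inj₁ refl = ⊥-elim (m≢x (≤-antisym m≤x (ℓ≤K Km)))
    ... | inj₂ (S , _ , S⊆H , lub)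
      with lub≰⇒∃≰ (_∈? S) lub (λ x≤m → m≢x (≤-antisym m≤x x≤m))
    ...   | h , h∈S , h≰m =
      subst (CoversIn K y) (sym j≡h∨y) (⋖-restrict Ky (K-∨-closed h y Kh Ky) y⋖h∨y)
      where
      Kh : K h
      Kh = H⊆K h (S⊆H h∈S)
      h≤x : h ≤ x
      h≤x = proj₂ (proj₁ lub) h h∈S
      m≤y : m ≤ y
      m≤y = proj₂ (proj₁ m=x∧y) y (inj₂ refl)
      h≰y : ¬ h ≤ y
      h≰y h≤y = h≰m (proj₂ m=x∧y h (Kh , λ { _ (inj₁ refl) → h≤x ; _ (inj₂ refl) → h≤y }))
      y⋖h∨y : CoversIn full y (h ∨ y)
      y⋖h∨y = semimodular⇒⋖-∨ semimodular (ℓ⋖H h (S⊆H h∈S)) (ℓ≤K Ky)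
                (λ h∨y≡y → h≰y (subst (h ≤_) h∨y≡y (x≤x∨y h y)))
      h∨m≡x : h ∨ m ≡ x
      h∨m≡x = ⋖-absorb m⋖x (K-∨-closed h m Kh Km) h≰m h≤x
      x≤h∨y : x ≤ (h ∨ y)
      x≤h∨y = subst (_≤ (h ∨ y)) h∨m≡x (∨-least (x≤x∨y h y) (≤-trans m≤y (y≤x∨y h y)))
      j≡h∨y : j ≡ h ∨ y
      j≡h∨y = trans (lub-unique j=x∨y (∨-isJoinInK Kx Ky))
        (≤-antisym (∨-least x≤h∨y (y≤x∨y h y)) (∨-least (≤-trans h≤x (x≤x∨y x y)) (y≤x∨y x y)))

    K-geometric : Semimodular full → IsGeometric K
    K-geometric semimodular =
        ((ℓ , ℓ∈K) , (λ a b Ka Kb → a ∨ b , ∨-isJoinInK Ka Kb) , K-meet)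
      , K-atomistic
      , K-semimodular semimodular

module GeometricLattice {n : ℕ} {_≤_ : Fin n → Fin n → Set} {_∨_ _∧_ : Op₂ (Fin n)}
  (isLattice : IsLattice _≡_ _≤_ _∨_ _∧_) (geometric : Order.IsGeometric _≤_ (Order.full _≤_)) where

  open Order _≤_
  open LatticeFacts isLattice
  open IsLattice isLattice using (x∧y≤x; x∧y≤y) renaming (trans to ≤-trans; antisym to ≤-antisym)

  semimodular : Semimodular full
  semimodular = proj₂ (proj₂ geometric)

  atomistic : Atomistic full
  atomistic = proj₁ (proj₂ geometric)

  0̂ : Fin n
  0̂ = foldr _∧_ (proj₁ (proj₁ (proj₁ geometric))) (allFin n)

  0̂-least : IsLeastIn full 0̂
  0̂-least = tt , λ y _ → ⋀≤ (allFin n) (∈-allFin y)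
    where
    ⋀≤ : ∀ {b y} xs → y ∈ₗ xs → foldr _∧_ b xs ≤ y
    ⋀≤ (x ∷ xs) (here refl) = x∧y≤x x _
    ⋀≤ (x ∷ xs) (there y∈)  = ≤-trans (x∧y≤y x _) (⋀≤ xs y∈)

  0̂≤ : ∀ y → 0̂ ≤ y
  0̂≤ y = proj₂ 0̂-least y tt

  atom⇔0̂⋖ : ∀ a → AtomIn full a ⇔ CoversIn full 0̂ a
  atom⇔0̂⋖ a = mk⇔
    (λ (z , z-least , z⋖a) → subst (λ t → CoversIn full t a) (least-unique z-least 0̂-least) z⋖a)
    (λ 0̂⋖a → 0̂ , 0̂-least , 0̂⋖a)

  below : {P : Pred (Fin n) 0ℓ} → Decidable P → Fin n → Subset n
  below P? x = subset (λ a → P? a ×-dec ≤-dec a x)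

  ∈-below⇔ : ∀ {P : Pred (Fin n) 0ℓ} (P? : Decidable P) x a → a ∈ below P? x ⇔ (P a × a ≤ x)
  ∈-below⇔ P? x = ∈-subset⇔ (λ a → P? a ×-dec ≤-dec a x)

  atomistic-isLub : ∀ {P : Pred (Fin n) 0ℓ} (P? : Decidable P) → (∀ a → P a ⇔ AtomIn full a)
                  → ∀ x → IsLubIn full (_∈ below P? x) x
  atomistic-isLub P? P⇔atom x =
    lub-resp-⇔ (λ a → ⇔-sym (⇔-trans (∈-below⇔ P? x a) (P⇔atom a ×-⇔ ⇔-refl))) (atomistic x tt)

  atoms : Subset n
  atoms = subset (covers-dec 0̂)

  0̂⋖atoms : ∀ a → a ∈ atoms → CoversIn full 0̂ a
  0̂⋖atoms a = to (∈-subset⇔ (covers-dec 0̂) a)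

  atoms-below-isLub : ∀ x → IsLubIn full (_∈ below (covers-dec 0̂) x) x
  atoms-below-isLub = atomistic-isLub (covers-dec 0̂) (λ a → ⇔-sym (atom⇔0̂⋖ a))

  generated-by-atoms : ∀ x → Gen full atoms 0̂ x
  generated-by-atoms x with nonempty? (below (covers-dec 0̂) x)
  ... | yes nonempty = inj₂ (below (covers-dec 0̂) x , nonempty , below⊆atoms , atoms-below-isLub x)
    where
    below⊆atoms : below (covers-dec 0̂) x ⊆ atoms
    below⊆atoms {a} a∈ =
      from (∈-subset⇔ (covers-dec 0̂) a) (proj₁ (to (∈-below⇔ (covers-dec 0̂) x a) a∈))
  ... | no empty = inj₁ (≤-antisym (proj₂ (atoms-below-isLub x) 0̂ (tt , λ a a∈ → ⊥-elim (empty (a , a∈))))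
                                   (0̂≤ x))

  module Minors (irrL : Subset n) (irr⇔ : ∀ x → x ∈ irrL ⇔ JoinIrr full x) where

    irr⇔0̂⋖ : ∀ x → x ∈ irrL ⇔ CoversIn full 0̂ x
    irr⇔0̂⋖ x = ⇔-trans (irr⇔ x) (⇔-trans (⇔-sym (atoms⇔joinIrr x)) (∈-subset⇔ (covers-dec 0̂) x))
      where
      open CoverGenerated 0̂⋖atoms (λ y → mk⇔ (λ _ → generated-by-atoms y) (λ _ → tt))
        renaming (H⇔joinIrr to atoms⇔joinIrr)

    irr⇔atom : ∀ x → x ∈ irrL ⇔ AtomIn full x
    irr⇔atom x = ⇔-trans (irr⇔0̂⋖ x) (⇔-sym (atom⇔0̂⋖ x))

    coversOf : Fin n → Subset n
    coversOf ℓ = subset (covers-dec ℓ)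

    CoverGeneratedBy : Carrier → Subset n → Fin n → Set
    CoverGeneratedBy K H ℓ = (∀ h → h ∈ H → CoversIn full ℓ h) × (∀ x → K x ⇔ Gen full H ℓ x)

    minor⇒coverGenerated : ∀ {K H} → IsMinor full irrL K H → Σ (Fin n) (CoverGeneratedBy K H)
    minor⇒coverGenerated base = 0̂ , (λ h h∈ → to (irr⇔0̂⋖ h) h∈)
                              , λ x → mk⇔ (λ _ → Gen-mono atoms⊆irr x (generated-by-atoms x)) (λ _ → tt)
      where
      atoms⊆irr : atoms ⊆ irrL
      atoms⊆irr {a} a∈ = from (irr⇔0̂⋖ a) (0̂⋖atoms a a∈)
    minor⇒coverGenerated (del {G = G} I z minor _ z-least) with minor⇒coverGenerated minor
    ... | ℓ , ℓ⋖G , K⇔ = z , z⋖G─I , Gen-∨-closed⇔ K-∨-closed (λ j j∈ → H⊆K j (p─q⊆p G I j∈))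
      where
      open CoverGenerated ℓ⋖G K⇔
      z⋖G─I : ∀ h → h ∈ G ─ I → CoversIn full z h
      z⋖G─I h h∈ =
        subst (λ t → CoversIn full t h) (least-unique ℓ-least z-least) (ℓ⋖G h (p─q⊆p G I h∈))
    minor⇒coverGenerated (con {K} {G} I i₀ J minor _ i₀-lub J⇔) with minor⇒coverGenerated minor
    ... | ℓ , ℓ⋖G , K⇔ = i₀ , i₀⋖J , Gen-∨-closed⇔ K-∨-closed J⊆K
      where
      open CoverGenerated ℓ⋖G K⇔
      i₀∈K : K i₀
      i₀∈K = proj₁ (proj₁ i₀-lub)
      J-elem : ∀ x → x ∈ J → ∃ λ g → g ∈ G × x ≡ g ∨ i₀ × x ≢ i₀
      J-elem x x∈J with to (J⇔ x) x∈J
      ... | (g , g∈G , g∨i₀=x) , x≢i₀ =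
        g , g∈G , lub-unique g∨i₀=x (∨-isJoinInK (H⊆K g g∈G) i₀∈K) , x≢i₀
      J⊆K : ∀ x → x ∈ J → K x
      J⊆K x x∈J with J-elem x x∈J
      ... | g , g∈G , refl , _ = K-∨-closed g i₀ (H⊆K g g∈G) i₀∈K
      i₀⋖J : ∀ x → x ∈ J → CoversIn full i₀ x
      i₀⋖J x x∈J with J-elem x x∈J
      ... | g , g∈G , refl , x≢i₀ = semimodular⇒⋖-∨ semimodular (ℓ⋖G g g∈G) (ℓ≤K i₀∈K) x≢i₀

    -- An irreducible g ≤ x with g ≰ ℓ exists by atomisticity, and then ℓ < g ∨ ℓ ≤ x forces g ∨ ℓ = x.
    ⋖⇒irr∨≡ : ∀ {ℓ x} → CoversIn full ℓ x → ∃ λ g → g ∈ irrL × g ∨ ℓ ≡ x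
    ⋖⇒irr∨≡ {ℓ} {x} ℓ⋖x
      with lub≰⇒∃≰ (_∈? below (_∈? irrL) x) (atomistic-isLub (_∈? irrL) irr⇔atom x) x≰ℓ
      where
      x≰ℓ : ¬ x ≤ ℓ
      x≰ℓ x≤ℓ = ⋖⇒≢ ℓ⋖x (≤-antisym (⋖⇒≤ ℓ⋖x) x≤ℓ)
    ... | g , g∈ , g≰ℓ with to (∈-below⇔ (_∈? irrL) x g) g∈
    ...   | g∈irrL , g≤x = g , g∈irrL , ⋖-absorb ℓ⋖x tt g≰ℓ g≤x

    irr⇒⋖-∨ : ∀ {ℓ g} → g ∈ irrL → g ∨ ℓ ≢ ℓ → CoversIn full ℓ (g ∨ ℓ)
    irr⇒⋖-∨ {ℓ} {g} g∈irrL = semimodular⇒⋖-∨ semimodular (to (irr⇔0̂⋖ g) g∈irrL) (0̂≤ ℓ)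

    coversOf⇔contraction : ∀ ℓ x → x ∈ coversOf ℓ ⇔ ((∃ λ g → g ∈ irrL × IsJoin2 full g ℓ x) × x ≢ ℓ)
    coversOf⇔contraction ℓ x = mk⇔ (λ x∈ → toContraction (to (∈-subset⇔ (covers-dec ℓ) x) x∈))
                                   (λ c → from (∈-subset⇔ (covers-dec ℓ) x) (fromContraction c))
      where
      toContraction : CoversIn full ℓ x → (∃ λ g → g ∈ irrL × IsJoin2 full g ℓ x) × x ≢ ℓ
      toContraction ℓ⋖x =
        let g , g∈irrL , g∨ℓ≡x = ⋖⇒irr∨≡ ℓ⋖x
        in (g , g∈irrL , subst (IsJoin2 full g ℓ) g∨ℓ≡x (∨-isJoinIn g ℓ tt)) , λ x≡ℓ → ⋖⇒≢ ℓ⋖x (sym x≡ℓ)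
      fromContraction : (∃ λ g → g ∈ irrL × IsJoin2 full g ℓ x) × x ≢ ℓ → CoversIn full ℓ x
      fromContraction ((g , g∈irrL , g∨ℓ=x) , x≢ℓ) =
        subst (CoversIn full ℓ) g∨ℓ≡x (irr⇒⋖-∨ g∈irrL (λ g∨ℓ≡ℓ → x≢ℓ (trans (sym g∨ℓ≡x) g∨ℓ≡ℓ)))
        where
        g∨ℓ≡x : g ∨ ℓ ≡ x
        g∨ℓ≡x = lub-unique (∨-isJoinIn g ℓ tt) g∨ℓ=x

    coverGenerated⇒minor : ∀ ℓ H → (∀ h → h ∈ H → CoversIn full ℓ h)
                         → Σ Carrier (λ K → IsMinor full irrL K H × (∀ x → K x ⇔ Gen full H ℓ x))
    coverGenerated⇒minor ℓ H ℓ⋖H =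
      Gen K₁ H ℓ , subst (λ H′ → IsMinor full irrL (Gen K₁ H′ ℓ) H′) (p─[p─q]≡q H⊆J) deleted
                 , Gen-∨-closed⇔ K-∨-closed (λ h h∈ → H⊆K h (H⊆J h∈))
      where
      J : Subset n
      J = coversOf ℓ
      K₁ : Carrier
      K₁ = Gen full J ℓ
      open CoverGenerated {K₁} (λ h → to (∈-subset⇔ (covers-dec ℓ) h)) (λ _ → ⇔-refl)
      H⊆J : H ⊆ J
      H⊆J {h} h∈ = from (∈-subset⇔ (covers-dec ℓ) h) (ℓ⋖H h h∈)
      contracted : IsMinor full irrL K₁ J
      contracted = con (below (_∈? irrL) ℓ) ℓ J base
        (λ {a} a∈ → proj₁ (to (∈-below⇔ (_∈? irrL) ℓ a) a∈))
        (atomistic-isLub (_∈? irrL) irr⇔atom ℓ) (coversOf⇔contraction ℓ)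
      deleted : IsMinor full irrL (Gen K₁ (J ─ (J ─ H)) ℓ) (J ─ (J ─ H))
      deleted = del (J ─ H) ℓ contracted (p─q⊆p J H) ℓ-least

    minor⇒minimal×geometric : ∀ K H → IsMinor full irrL K H → (∀ x → x ∈ H ⇔ JoinIrr K x) × IsGeometric K
    minor⇒minimal×geometric K H minor with minor⇒coverGenerated minor
    ... | ℓ , ℓ⋖H , K⇔ = H⇔joinIrr , K-geometric semimodular
      where open CoverGenerated ℓ⋖H K⇔

mainTheorem9 : (n : ℕ) (_≤_ : Fin n → Fin n → Set) (_∨_ _∧_ : Op₂ (Fin n))
    → IsLattice _≡_ _≤_ _∨_ _∧_
    → Order.IsGeometric _≤_ (Order.full _≤_)
    → (irrL : Subset n)
    → (∀ x → (x ∈ irrL) ⇔ Order.JoinIrr _≤_ (Order.full _≤_) x)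
    → ((K : Order.Carrier _≤_) (H : Subset n)
        → Order.IsMinor _≤_ (Order.full _≤_) irrL K H
        → Σ (Fin n) (λ ℓ → (∀ h → h ∈ H → Order.CoversIn _≤_ (Order.full _≤_) ℓ h)
            × (∀ x → K x ⇔ Order.Gen _≤_ (Order.full _≤_) H ℓ x)))
    × ((ℓ : Fin n) (H : Subset n)
        → (∀ h → h ∈ H → Order.CoversIn _≤_ (Order.full _≤_) ℓ h)
        → Σ (Order.Carrier _≤_) (λ K → Order.IsMinor _≤_ (Order.full _≤_) irrL K H
            × (∀ x → K x ⇔ Order.Gen _≤_ (Order.full _≤_) H ℓ x)))
    × ((K : Order.Carrier _≤_) (H : Subset n)
        → Order.IsMinor _≤_ (Order.full _≤_) irrL K H
        → (∀ x → (x ∈ H) ⇔ Order.JoinIrr _≤_ K x) × Order.IsGeometric _≤_ K)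
mainTheorem9 n _≤_ _∨_ _∧_ isLattice geometric irrL irr⇔ =
  (λ K H → minor⇒coverGenerated) , coverGenerated⇒minor , minor⇒minimal×geometric
  where open GeometricLattice.Minors isLattice geometric irrL irr⇔
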